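{- Let $G$ be a finite group and $S\subseteq G\setminus\{1\}$ an inverse-closed subset that is closed under conjugation and generates $G$, and let $\Gamma=\mathrm{Cay}(G,S)$. Let $\tau=\{W_1,\ldots,W_n\}$ be an equitable partition of $\Gamma$ with quotient matrix $M_\tau=(c_{ij})_{1\le i,j\le n}$, and for $x\in G$ let $\tau x=\{W_1x,\ldots,W_nx\}$ where $W_ix=\{wx:w\in W_i\}$. Then: (a) for every $x\in G$, $\tau x$ is an equitable partition of $\Gamma$ with quotient matrix $M_{\tau x}=M_\tau$; (b) for $1\le i,j\le n$ and every $x\in W_i$, $|\{g\in S: x\in gW_j\}|=c_{ij}$; (c) for $1\le i,j\le n$ and every $x\in W_i$, $|\{g\in S: x\in W_jg\}|=c_{ij}$.
   Context: For a finite group $G$ and inverse-closed $S\subseteq G\setminus\{1\}$, the Cayley graph $\mathrm{Cay}(G,S)$ has vertex set $G$, with $x,y$ adjacent iff $yx^{ -1}\in S$. An equitable partition $\{W_1,\ldots,W_n\}$ of a graph with quotient matrix $(c_{ij})$ is a partition of the vertex set such that every vertex of $W_i$ has exactly $c_{ij}$ neighbours in $W_j$. -}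

module Defs where

open import Level using (Level; _⊔_)
open import Algebra.Bundles using (Group)
open import Data.Nat using (ℕ)
open import Data.Fin using (Fin)
open import Data.List using (List; length; foldr; _∷_)
open import Data.List.Relation.Unary.Any using (Any)
open import Data.List.Relation.Unary.All using (All)
open import Data.List.Relation.Unary.AllPairs using (AllPairs)
open import Data.Product using (Σ; ∃; _×_; _,_)
open import Data.Sum using (_⊎_)
open import Function.Bundles using (_⇔_)
open import Relation.Binary.Definitions using (_Respects_)
open import Relation.Binary.PropositionalEquality using (_≡_)
open import Relation.Unary using (Pred)
open import Relation.Nullary using (¬_)

module _ {c ℓ : Level} (G : Group c ℓ) where
  open Group G

  _∈≈_ : Carrier → List Carrier → Set (c ⊔ ℓ)
  x ∈≈ xs = Any (x ≈_) xs

  IsFiniteGroup : Set (c ⊔ ℓ)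
  IsFiniteGroup = Σ (List Carrier) λ xs → ∀ x → x ∈≈ xs

  HasSize : ∀ {p} → Pred Carrier p → ℕ → Set (c ⊔ ℓ ⊔ p)
  HasSize P k =
    Σ (List Carrier) λ ys →
      length ys ≡ k × AllPairs (λ a b → ¬ (a ≈ b)) ys × (∀ y → (P y ⇔ (y ∈≈ ys)))

  Generates : ∀ {s} → Pred Carrier s → Set (c ⊔ ℓ ⊔ s)
  Generates S = ∀ x → Σ (List Carrier) λ gs →
    All (λ g → S g ⊎ S (g ⁻¹)) gs × x ≈ foldr _∙_ ε gs

  record IsNormalConnectionSet {s} (S : Pred Carrier s) : Set (c ⊔ ℓ ⊔ s) where
    field
      respects   : S Respects _≈_
      noIdentity : ∀ g → S g → ¬ (g ≈ ε)
      invClosed  : ∀ g → S g → S (g ⁻¹)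
      conjClosed : ∀ g h → S g → S ((h ∙ g) ∙ h ⁻¹)
      generates  : Generates S

  CayAdj : ∀ {s} → Pred Carrier s → Carrier → Carrier → Set s
  CayAdj S x y = S (y ∙ x ⁻¹)

  record IsPartition {n : ℕ} {w} (W : Fin n → Pred Carrier w) : Set (c ⊔ ℓ ⊔ w) where
    field
      blockRespects : ∀ i → W i Respects _≈_
      nonempty      : ∀ i → ∃ λ x → W i x
      covers        : ∀ x → ∃ λ i → W i x
      disjoint      : ∀ i j x → W i x → W j x → i ≡ j

  record IsEquitablePartition {s} (S : Pred Carrier s) {n : ℕ} {w}
      (W : Fin n → Pred Carrier w) (C : Fin n → Fin n → ℕ) : Set (c ⊔ ℓ ⊔ s ⊔ w) where
    field
      partition : IsPartition W
      equitable : ∀ i j x → W i x →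
                  HasSize (λ y → W j y × CayAdj S x y) (C i j)

  RightTranslate : ∀ {w} → Pred Carrier w → Carrier → Pred Carrier (c ⊔ ℓ ⊔ w)
  RightTranslate W x y = ∃ λ v → W v × y ≈ v ∙ x

  LeftTranslate : ∀ {w} → Carrier → Pred Carrier w → Pred Carrier (c ⊔ ℓ ⊔ w)
  LeftTranslate g W y = ∃ λ v → W v × y ≈ g ∙ v

  translatePartition : ∀ {n w} → (Fin n → Pred Carrier w) → Carrier →
                       Fin n → Pred Carrier (c ⊔ ℓ ⊔ w)
  translatePartition W x i = RightTranslate (W i) x

-- Right multiplication by x is an automorphism of Cay(G,S), since (a x)(b x)⁻¹ = a b⁻¹;
-- it maps τ to τx and preserves all neighbour counts, which gives (a).  For (b) and (c),
-- the neighbours y ∈ W_j of x correspond to g = x y⁻¹ and g = y⁻¹ x respectively.  The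
-- first lies in S iff y x⁻¹ does because S is inverse-closed; the second is conjugate to
-- x y⁻¹ (by y), so it lies in S because S is moreover closed under conjugation.
module Submission where

open import Defs
open import Level using (Level; _⊔_)
open import Algebra.Bundles using (Group)
open import Data.Nat using (ℕ)
open import Data.Fin using (Fin)
open import Data.List using (map)
open import Data.List.Properties using (length-map)
import Data.List.Membership.Setoid.Properties as Membership
import Data.List.Relation.Unary.AllPairs as AllPairs
import Data.List.Relation.Unary.AllPairs.Properties as AllPairs
open import Data.Product using (_×_; _,_; ∃)
open import Function.Bundles using (mk⇔; Equivalence)
open import Function.Definitions using (Congruent; Injective)
open import Relation.Binary.Definitions using (_Respects_)
open import Relation.Binary.PropositionalEquality using () renaming (trans to ≡-trans)
open import Relation.Unary using (Pred)

module GroupTranslation {c ℓ : Level} (G : Group c ℓ) where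
  open Group G
  open import Algebra.Properties.Group G
  open import Relation.Binary.Reasoning.Setoid setoid

  hasSize-map : ∀ {p q} {P : Pred Carrier p} {Q : Pred Carrier q} (f : Carrier → Carrier) →
    Congruent _≈_ _≈_ f → Injective _≈_ _≈_ f → Q Respects _≈_ →
    (∀ {y} → P y → Q (f y)) → (∀ {z} → Q z → ∃ λ y → P y × z ≈ f y) →
    ∀ {k} → HasSize G P k → HasSize G Q k
  hasSize-map {Q = Q} f f-cong f-inj Q-resp P⇒Q Q⇒P (ys , |ys|≡k , distinct , P⇔∈ys) =
    map f ys , ≡-trans (length-map f ys) |ys|≡k ,
    AllPairs.map⁺ (AllPairs.map (λ y≉y′ fy≈fy′ → y≉y′ (f-inj fy≈fy′)) distinct) ,
    λ z → mk⇔ (Q⇒∈ z) (∈⇒Q z)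
    where
    Q⇒∈ : ∀ z → Q z → _∈≈_ G z (map f ys)
    Q⇒∈ z Qz with Q⇒P Qz
    ... | y , Py , z≈fy =
      Membership.∈-resp-≈ setoid (sym z≈fy)
        (Membership.∈-map⁺ setoid setoid f-cong (Equivalence.to (P⇔∈ys y) Py))

    ∈⇒Q : ∀ z → _∈≈_ G z (map f ys) → Q z
    ∈⇒Q z z∈ with Membership.∈-map⁻ setoid setoid z∈
    ... | y , y∈ys , z≈fy = Q-resp (sym z≈fy) (P⇒Q (Equivalence.from (P⇔∈ys y) y∈ys))

  //-invariantʳ : ∀ a b x → (a ∙ x) // (b ∙ x) ≈ a // b
  //-invariantʳ a b x = begin
    (a ∙ x) ∙ (b ∙ x) ⁻¹     ≈⟨ ∙-congˡ (⁻¹-anti-homo-∙ b x) ⟩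
    (a ∙ x) ∙ (x ⁻¹ ∙ b ⁻¹)  ≈⟨ assoc a x (x ⁻¹ ∙ b ⁻¹) ⟩
    a ∙ (x ∙ (x ⁻¹ ∙ b ⁻¹))  ≈⟨ ∙-congˡ (\\-leftDividesˡ x (b ⁻¹)) ⟩
    a ∙ b ⁻¹                 ∎

  \\-conjugate : ∀ a b → (a ∙ (a \\ b)) ∙ a ⁻¹ ≈ b // a
  \\-conjugate a b = ∙-congʳ (\\-leftDividesˡ a b)

  //-conjugate : ∀ a b → (a ⁻¹ ∙ (b // a)) ∙ a ⁻¹ ⁻¹ ≈ a \\ b
  //-conjugate a b = begin
    (a ⁻¹ ∙ (b // a)) ∙ a ⁻¹ ⁻¹  ≈⟨ ∙-congˡ (⁻¹-involutive a) ⟩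
    (a ⁻¹ ∙ (b // a)) ∙ a        ≈⟨ assoc (a ⁻¹) (b // a) a ⟩
    a ⁻¹ ∙ ((b // a) ∙ a)        ≈⟨ ∙-congˡ (//-rightDividesˡ a b) ⟩
    a ⁻¹ ∙ b                     ∎

  translatePartition-isPartition : ∀ {n w} {W : Fin n → Pred Carrier w} →
    IsPartition G W → ∀ x → IsPartition G (translatePartition G W x)
  translatePartition-isPartition {W = W} partition x = record
    { blockRespects = λ i y≈y′ (v , Wv , y≈vx) → v , Wv , trans (sym y≈y′) y≈vx
    ; nonempty      = λ i → let v , Wv = nonempty i in v ∙ x , v , Wv , refl
    ; covers        = λ y → let i , Wyx⁻¹ = covers (y // x) in
                            i , y // x , Wyx⁻¹ , sym (//-rightDividesˡ x y)
    ; disjoint      = λ i j y (v , Wiv , y≈vx) (v′ , Wjv′ , y≈v′x) →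
        disjoint i j v Wiv (blockRespects j (∙-cancelʳ x v′ v (trans (sym y≈v′x) y≈vx)) Wjv′)
    }
    where open IsPartition partition

module CayleyGraph {c ℓ s : Level} (G : Group c ℓ) (S : Pred (Group.Carrier G) s) where
  open Group G
  open import Algebra.Properties.Group G
  open GroupTranslation G

  NeighboursIn : ∀ {w} → Pred Carrier w → Carrier → Pred Carrier (s ⊔ w)
  NeighboursIn W x y = W y × CayAdj G S x y

  module _ (S-resp : S Respects _≈_) where

    CayAdj-sym : (S-inv : ∀ g → S g → S (g ⁻¹)) → ∀ {x y} → CayAdj G S x y → CayAdj G S y x
    CayAdj-sym S-inv {x} {y} xy = S-resp (⁻¹-anti-homo-// y x) (S-inv (y // x) xy)

    module _ (S-conj : ∀ g h → S g → S ((h ∙ g) ∙ h ⁻¹)) where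

      leftQuotient⇒CayAdj : ∀ {x y} → S (x \\ y) → CayAdj G S x y
      leftQuotient⇒CayAdj {x} {y} S[x\\y] = S-resp (\\-conjugate x y) (S-conj _ x S[x\\y])

      CayAdj⇒leftQuotient : ∀ {x y} → CayAdj G S x y → S (x \\ y)
      CayAdj⇒leftQuotient {x} {y} xy = S-resp (//-conjugate x y) (S-conj _ (x ⁻¹) xy)

    neighbours-rightTranslate : ∀ {w} {W : Pred Carrier w} {v x y k} → y ≈ v ∙ x →
      HasSize G (NeighboursIn W v) k → HasSize G (NeighboursIn (RightTranslate G W x) y) k
    neighbours-rightTranslate {W = W} {v} {x} {y} y≈vx =
      hasSize-map (_∙ x) ∙-congʳ (λ {a} {b} → ∙-cancelʳ x a b) resp
        (λ {u} (Wu , vu) → (u , Wu , refl) , S-resp (sym (ux//y≈u//v u)) vu)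
        (λ {z} ((u , Wu , z≈ux) , yz) →
           u , (Wu , S-resp (trans (∙-congʳ z≈ux) (ux//y≈u//v u)) yz) , z≈ux)
      where
      ux//y≈u//v : ∀ u → (u ∙ x) // y ≈ u // v
      ux//y≈u//v u = trans (∙-congˡ (⁻¹-cong y≈vx)) (//-invariantʳ u v x)

      resp : NeighboursIn (RightTranslate G W x) y Respects _≈_
      resp z≈z′ ((u , Wu , z≈ux) , yz) = (u , Wu , trans (sym z≈z′) z≈ux) , S-resp (∙-congʳ z≈z′) yz

    neighbours-leftTranslates : (S-inv : ∀ g → S g → S (g ⁻¹)) →
      ∀ {w} {W : Pred Carrier w} {x k} → HasSize G (NeighboursIn W x) k →
      HasSize G (λ g → S g × LeftTranslate G g W x) k
    neighbours-leftTranslates S-inv {x = x} =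
      hasSize-map (x //_) (//-cong₂ refl) (λ e → ⁻¹-injective (∙-cancelˡ x _ _ e))
        (λ g≈g′ (Sg , v , Wv , x≈gv) → S-resp g≈g′ Sg , v , Wv , trans x≈gv (∙-congʳ g≈g′))
        (λ {y} (Wy , xy) → CayAdj-sym S-inv xy , y , Wy , sym (//-rightDividesˡ y x))
        (λ {g} (Sg , v , Wv , x≈gv) → let g≈x//v = x≈z//y g v x (sym x≈gv) in
           v , (Wv , CayAdj-sym S-inv (S-resp g≈x//v Sg)) , g≈x//v)

    neighbours-rightTranslates : (S-inv : ∀ g → S g → S (g ⁻¹)) →
      (S-conj : ∀ g h → S g → S ((h ∙ g) ∙ h ⁻¹)) →
      ∀ {w} {W : Pred Carrier w} {x k} → HasSize G (NeighboursIn W x) k →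
      HasSize G (λ g → S g × RightTranslate G W g x) k
    neighbours-rightTranslates S-inv S-conj {x = x} =
      hasSize-map (_\\ x) (λ e → \\-cong₂ e refl) (λ e → ⁻¹-injective (∙-cancelʳ x _ _ e))
        (λ g≈g′ (Sg , v , Wv , x≈vg) → S-resp g≈g′ Sg , v , Wv , trans x≈vg (∙-congˡ g≈g′))
        (λ {y} (Wy , xy) → CayAdj⇒leftQuotient S-conj (CayAdj-sym S-inv xy) ,
                            y , Wy , sym (\\-leftDividesˡ y x))
        (λ {g} (Sg , v , Wv , x≈vg) → let g≈v\\x = y≈x\\z v g x (sym x≈vg) in
           v , (Wv , CayAdj-sym S-inv (leftQuotient⇒CayAdj S-conj (S-resp g≈v\\x Sg))) , g≈v\\x)

lemma3p1 : {c ℓ s w : Level} (G : Group c ℓ) → IsFiniteGroup G →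
    (S : Pred (Group.Carrier G) s) → IsNormalConnectionSet G S →
    {n : ℕ} (W : Fin n → Pred (Group.Carrier G) w) (C : Fin n → Fin n → ℕ) →
    IsEquitablePartition G S W C →
      ((x : Group.Carrier G) → IsEquitablePartition G S (translatePartition G W x) C)
      × ((i j : Fin n) (x : Group.Carrier G) → W i x →
           HasSize G (λ g → S g × LeftTranslate G g (W j) x) (C i j))
      × ((i j : Fin n) (x : Group.Carrier G) → W i x →
           HasSize G (λ g → S g × RightTranslate G (W j) g x) (C i j))
lemma3p1 G _ S normal W C equitablePartition =
  (λ x → record
    { partition = GroupTranslation.translatePartition-isPartition G partition x
    ; equitable = λ i j y (v , Wv , y≈vx) →
        neighbours-rightTranslate respects y≈vx (equitable i j v Wv)
    }) ,
  (λ i j x Wx → neighbours-leftTranslates respects invClosed (equitable i j x Wx)) ,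
  (λ i j x Wx → neighbours-rightTranslates respects invClosed conjClosed (equitable i j x Wx))
  where
  open CayleyGraph G S
  open IsNormalConnectionSet normal
  open IsEquitablePartition equitablePartition
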